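{- Let $G_1$ and $G_2$ be finite simple graphs on disjoint vertex sets and $r$ a positive integer. Then $\Sigma_r(G_1 * G_2)$ is the simplicial complex whose set of facets is the union of the facets of $\Sigma_r(G_1) * \Delta_{V(G_2)}$, the facets of $\Delta_{V(G_1)} * \Sigma_r(G_2)$, and the sets $\mathcal{E}^c=V(G_1)\cup V(G_2)\setminus\mathcal E$ for all $\mathcal{E}\subseteq V(G_1)\cup V(G_2)$ with $|\mathcal{E}|=r$, $\mathcal{E} \cap V(G_1)\neq\emptyset$ and $\mathcal{E} \cap V(G_2)\neq\emptyset$.
   Context: For a graph $H$, $\Sigma_r(H)$ is the simplicial complex generated by $V(H)\setminus W$ over all $r$-subsets $W\subseteq V(H)$ with $H[W]$ connected. The join $G_1*G_2$ of graphs is the graph on $V(G_1)\cup V(G_2)$ with edges $E(G_1)\cup E(G_2)\cup\{\{x,y\}: x\in V(G_1),y\in V(G_2)\}$. $\Delta_V$ is the simplex with vertex set $V$, and the join $\Delta_1*\Delta_2$ of complexes on disjoint vertex sets has facets $F_1\sqcup F_2$ with $F_i$ a facet of $\Delta_i$. -}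

module Defs where

open import Level using (0ℓ)
open import Data.Nat using (ℕ; _+_)
open import Data.Fin using (Fin; splitAt)
open import Data.Fin.Subset using (Subset; _∈_; _⊆_; ∁; ⊤; ⊥; ∣_∣)
open import Data.Vec using (_++_)
open import Data.Sum using (_⊎_; inj₁; inj₂)
open import Data.Product using (Σ; ∃; ∃-syntax; _×_; _,_)
open import Data.Unit using () renaming (⊤ to Unit)
open import Data.Empty using () renaming (⊥ to Empty)
open import Relation.Nullary using (¬_)
open import Relation.Binary.PropositionalEquality using (_≡_)

record Graph (n : ℕ) : Set₁ where
  field
    Adj    : Fin n → Fin n → Set
    sym    : ∀ {x y} → Adj x y → Adj y x
    irrefl : ∀ {x} → ¬ Adj x x
open Graph public

data WalkIn {n : ℕ} (G : Graph n) (W : Subset n) : Fin n → Fin n → Set where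
  here : ∀ {x} → x ∈ W → WalkIn G W x x
  step : ∀ {x y z} → x ∈ W → Adj G x y → WalkIn G W y z → WalkIn G W x z

InducedConnected : {n : ℕ} → Graph n → Subset n → Set
InducedConnected G W = ∀ x y → x ∈ W → y ∈ W → WalkIn G W x y

Complex : ℕ → Set₁
Complex n = Subset n → Set

IsFacet : {n : ℕ} → Complex n → Subset n → Set
IsFacet K F = K F × (∀ F′ → K F′ → F ⊆ F′ → F ≡ F′)

-- Σ_r(H): the complex generated by V(H) \ W over all r-subsets W with H[W] connected
-- (faces = subsets of some generator; no generators gives the void complex).
SigmaC : {n : ℕ} → ℕ → Graph n → Complex n
SigmaC r H F = ∃[ W ] (∣ W ∣ ≡ r × InducedConnected H W × F ⊆ ∁ W)

Simplex : (n : ℕ) → Complex n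
Simplex n F = Unit

-- Facets of the join of complexes on the disjoint vertex sets Fin n₁, Fin n₂
-- (embedded into Fin (n₁ + n₂) as the first n₁ and last n₂ elements):
-- F₁ ⊔ F₂ with Fᵢ a facet of Kᵢ.
IsJoinFacet : {n₁ n₂ : ℕ} → Complex n₁ → Complex n₂ → Subset (n₁ + n₂) → Set
IsJoinFacet {n₁} {n₂} K₁ K₂ F =
  ∃[ F₁ ] ∃[ F₂ ] (IsFacet K₁ F₁ × IsFacet K₂ F₂ × F ≡ F₁ ++ F₂)

JAdj : {n₁ n₂ : ℕ} → Graph n₁ → Graph n₂ → Fin n₁ ⊎ Fin n₂ → Fin n₁ ⊎ Fin n₂ → Set
JAdj G₁ G₂ (inj₁ a) (inj₁ b) = Adj G₁ a b
JAdj G₁ G₂ (inj₂ a) (inj₂ b) = Adj G₂ a b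
JAdj G₁ G₂ (inj₁ a) (inj₂ b) = Unit
JAdj G₁ G₂ (inj₂ a) (inj₁ b) = Unit

JAdj-sym : {n₁ n₂ : ℕ} (G₁ : Graph n₁) (G₂ : Graph n₂) (s t : Fin n₁ ⊎ Fin n₂) →
           JAdj G₁ G₂ s t → JAdj G₁ G₂ t s
JAdj-sym G₁ G₂ (inj₁ a) (inj₁ b) p = sym G₁ p
JAdj-sym G₁ G₂ (inj₂ a) (inj₂ b) p = sym G₂ p
JAdj-sym G₁ G₂ (inj₁ a) (inj₂ b) p = _
JAdj-sym G₁ G₂ (inj₂ a) (inj₁ b) p = _

JAdj-irrefl : {n₁ n₂ : ℕ} (G₁ : Graph n₁) (G₂ : Graph n₂) (s : Fin n₁ ⊎ Fin n₂) →
              ¬ JAdj G₁ G₂ s s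
JAdj-irrefl G₁ G₂ (inj₁ a) = irrefl G₁
JAdj-irrefl G₁ G₂ (inj₂ a) = irrefl G₂

_*G_ : {n₁ n₂ : ℕ} → Graph n₁ → Graph n₂ → Graph (n₁ + n₂)
_*G_ {n₁} G₁ G₂ = record
  { Adj    = λ x y → JAdj G₁ G₂ (splitAt n₁ x) (splitAt n₁ y)
  ; sym    = λ {x} {y} → JAdj-sym G₁ G₂ (splitAt n₁ x) (splitAt n₁ y)
  ; irrefl = λ {x} → JAdj-irrefl G₁ G₂ (splitAt n₁ x)
  }

V₁ : (n₁ n₂ : ℕ) → Subset (n₁ + n₂)
V₁ n₁ n₂ = ⊤ {n₁} ++ ⊥ {n₂}

V₂ : (n₁ n₂ : ℕ) → Subset (n₁ + n₂)
V₂ n₁ n₂ = ⊥ {n₁} ++ ⊤ {n₂}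

{-# OPTIONS --safe #-}

-- The facets of Σ_r(H) are exactly the complements of the r-sets W for which H[W] is connected:
-- these complements all have the same size, so none properly contains another.
-- Split such a W ⊆ V(G₁ * G₂) as W₁ ⊔ W₂. If W₂ = ∅ then (G₁ * G₂)[W] = G₁[W₁], which gives the
-- facets (V(G₁) ∖ W₁) ⊔ V(G₂) of Σ_r(G₁) * Δ; symmetrically if W₁ = ∅. If both parts are nonempty,
-- W is connected in the join whatever G₁ and G₂ are, because every vertex of W₁ is adjacent to
-- every vertex of W₂.

module Submission where

open import Defs
open import Data.Nat using (ℕ; _≤_; _+_; suc)
open import Data.Nat.Properties using (+-identityʳ; <-irrefl)
open import Data.Bool using (false; not)
open import Data.Fin using (Fin; zero; suc; _↑ˡ_; _↑ʳ_)
open import Data.Fin.Properties using (↑ˡ-injective; ↑ʳ-injective; splitAt-↑ˡ; splitAt-↑ʳ)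
open import Data.Fin.Subset using (Subset; ∁; ∣_∣; _∩_; Nonempty; _∈_; _⊆_; ⊤; ⊥; inside; outside)
open import Data.Fin.Subset.Properties
  using (_∈?_; ⊆-refl; ⊆-antisym; ⊆⊤; ∉⊥; ∣⊥∣≡0; p⊂q⇒∣p∣<∣q∣; ∁p⊆∁q⇒p⊇q; ∩-identityʳ; ∩-zeroʳ;
         nonempty?; Empty-unique)
open import Data.Vec using (_∷_; []; _++_; here; there)
import Data.Vec as Vec
open import Data.Vec.Properties using (map-++; map-replicate; zipWith-++)
open import Data.Sum using (_⊎_; inj₁; inj₂)
open import Data.Product using (∃-syntax; _×_; _,_)
import Data.Product as Product
open import Data.Empty using (⊥-elim)
open import Function using (id)
open import Function.Bundles using (_⇔_; mk⇔; Equivalence)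
import Function.Properties.Equivalence as ⇔
open import Function.Definitions using (Injective)
open import Relation.Nullary using (yes; no; contradiction)
open import Relation.Binary.PropositionalEquality
  using (_≡_; refl; cong; cong₂; subst; trans) renaming (sym to ≡-sym)

open Equivalence using (to; from)

∈-++⁺ˡ : ∀ {m n} {p : Subset m} {x} (q : Subset n) → x ∈ p → x ↑ˡ n ∈ p ++ q
∈-++⁺ˡ q here        = here
∈-++⁺ˡ q (there x∈p) = there (∈-++⁺ˡ q x∈p)

∈-++⁺ʳ : ∀ {m n} (p : Subset m) {q : Subset n} {y} → y ∈ q → m ↑ʳ y ∈ p ++ q
∈-++⁺ʳ []      y∈q = y∈q
∈-++⁺ʳ (_ ∷ p) y∈q = there (∈-++⁺ʳ p y∈q)

∈-++⁻ : ∀ {m n} (p : Subset m) {q : Subset n} {x} → x ∈ p ++ q →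
        (∃[ a ] (a ↑ˡ n ≡ x × a ∈ p)) ⊎ (∃[ b ] (m ↑ʳ b ≡ x × b ∈ q))
∈-++⁻ []           x∈q      = inj₂ (_ , refl , x∈q)
∈-++⁻ (inside ∷ p) here     = inj₁ (zero , refl , here)
∈-++⁻ (_ ∷ p)      (there x∈) with ∈-++⁻ p x∈
... | inj₁ (a , refl , a∈p) = inj₁ (suc a , refl , there a∈p)
... | inj₂ (b , refl , b∈q) = inj₂ (b , refl , b∈q)

∈-++⊥⁻ : ∀ {m n} (p : Subset m) {x} → x ∈ p ++ ⊥ {n} → ∃[ a ] (a ↑ˡ n ≡ x × a ∈ p)
∈-++⊥⁻ p x∈ with ∈-++⁻ p x∈
... | inj₁ left             = left
... | inj₂ (_ , _ , b∈⊥) = ⊥-elim (∉⊥ b∈⊥)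

∈-⊥++⁻ : ∀ {m n} (q : Subset n) {x} → x ∈ ⊥ {m} ++ q → ∃[ b ] (m ↑ʳ b ≡ x × b ∈ q)
∈-⊥++⁻ {m} q x∈ with ∈-++⁻ (⊥ {m}) x∈
... | inj₁ (_ , _ , a∈⊥) = ⊥-elim (∉⊥ a∈⊥)
... | inj₂ right             = right

∣p++q∣≡∣p∣+∣q∣ : ∀ {m n} (p : Subset m) (q : Subset n) → ∣ p ++ q ∣ ≡ ∣ p ∣ + ∣ q ∣
∣p++q∣≡∣p∣+∣q∣ []            q = refl
∣p++q∣≡∣p∣+∣q∣ (inside  ∷ p) q = cong suc (∣p++q∣≡∣p∣+∣q∣ p q)
∣p++q∣≡∣p∣+∣q∣ (outside ∷ p) q = ∣p++q∣≡∣p∣+∣q∣ p q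

∣p++⊥∣≡∣p∣ : ∀ {m n} (p : Subset m) → ∣ p ++ ⊥ {n} ∣ ≡ ∣ p ∣
∣p++⊥∣≡∣p∣ {n = n} p =
  trans (∣p++q∣≡∣p∣+∣q∣ p ⊥) (trans (cong (∣ p ∣ +_) (∣⊥∣≡0 n)) (+-identityʳ ∣ p ∣))

∣⊥++q∣≡∣q∣ : ∀ {m n} (q : Subset n) → ∣ ⊥ {m} ++ q ∣ ≡ ∣ q ∣
∣⊥++q∣≡∣q∣ {m} q = trans (∣p++q∣≡∣p∣+∣q∣ (⊥ {m}) q) (cong (_+ ∣ q ∣) (∣⊥∣≡0 m))

∁⊥≡⊤ : ∀ n → ∁ (⊥ {n}) ≡ ⊤
∁⊥≡⊤ n = map-replicate not false n

∁[p++⊥]≡∁p++⊤ : ∀ {m n} (p : Subset m) → ∁ (p ++ ⊥ {n}) ≡ ∁ p ++ ⊤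
∁[p++⊥]≡∁p++⊤ {n = n} p = trans (map-++ not p ⊥) (cong (∁ p ++_) (∁⊥≡⊤ n))

∁[⊥++q]≡⊤++∁q : ∀ {m n} (q : Subset n) → ∁ (⊥ {m} ++ q) ≡ ⊤ ++ ∁ q
∁[⊥++q]≡⊤++∁q {m} q = trans (map-++ not ⊥ q) (cong (_++ ∁ q) (∁⊥≡⊤ m))

[p++q]∩V₁≡p++⊥ : ∀ {m n} (p : Subset m) (q : Subset n) → (p ++ q) ∩ V₁ m n ≡ p ++ ⊥
[p++q]∩V₁≡p++⊥ p q = trans (zipWith-++ _ p q ⊤ ⊥) (cong₂ _++_ (∩-identityʳ p) (∩-zeroʳ q))

[p++q]∩V₂≡⊥++q : ∀ {m n} (p : Subset m) (q : Subset n) → (p ++ q) ∩ V₂ m n ≡ ⊥ ++ q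
[p++q]∩V₂≡⊥++q p q = trans (zipWith-++ _ p q ⊥ ⊤) (cong₂ _++_ (∩-zeroʳ p) (∩-identityʳ q))

Nonempty-[p++q]∩V₁⇔ : ∀ {m n} (p : Subset m) (q : Subset n) →
                      Nonempty ((p ++ q) ∩ V₁ m n) ⇔ Nonempty p
Nonempty-[p++q]∩V₁⇔ p q rewrite [p++q]∩V₁≡p++⊥ p q = mk⇔
  (λ (_ , x∈) → let a , _ , a∈p = ∈-++⊥⁻ p x∈ in a , a∈p)
  (λ (a , a∈p) → _ , ∈-++⁺ˡ ⊥ a∈p)

Nonempty-[p++q]∩V₂⇔ : ∀ {m n} (p : Subset m) (q : Subset n) →
                      Nonempty ((p ++ q) ∩ V₂ m n) ⇔ Nonempty q
Nonempty-[p++q]∩V₂⇔ p q rewrite [p++q]∩V₂≡⊥++q p q = mk⇔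
  (λ (_ , x∈) → let b , _ , b∈q = ∈-⊥++⁻ q x∈ in b , b∈q)
  (λ (b , b∈q) → _ , ∈-++⁺ʳ ⊥ b∈q)

q≡⊥⊎p≡⊥⊎both-nonempty : ∀ {m n} (p : Subset m) (q : Subset n) →
                         q ≡ ⊥ ⊎ p ≡ ⊥ ⊎ (Nonempty p × Nonempty q)
q≡⊥⊎p≡⊥⊎both-nonempty p q with nonempty? p | nonempty? q
... | _          | no q-empty  = inj₁ (Empty-unique q-empty)
... | no p-empty | yes _       = inj₂ (inj₁ (Empty-unique p-empty))
... | yes p≢⊥    | yes q≢⊥     = inj₂ (inj₂ (p≢⊥ , q≢⊥))

p⊆q⇒∣p∣≡∣q∣⇒p≡q : ∀ {n} {p q : Subset n} → p ⊆ q → ∣ p ∣ ≡ ∣ q ∣ → p ≡ q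
p⊆q⇒∣p∣≡∣q∣⇒p≡q {p = p} {q} p⊆q ∣p∣≡∣q∣ = ⊆-antisym p⊆q q⊆p
  where
  q⊆p : q ⊆ p
  q⊆p {x} x∈q with x ∈? p
  ... | yes x∈p = x∈p
  ... | no  x∉p = contradiction (p⊂q⇒∣p∣<∣q∣ (p⊆q , x , x∈q , x∉p)) (<-irrefl ∣p∣≡∣q∣)

ConnectedComplement : ∀ {n} → ℕ → Graph n → Subset n → Subset n → Set
ConnectedComplement r H W F = ∣ W ∣ ≡ r × InducedConnected H W × F ≡ ∁ W

IsFacet-SigmaC⇔ : ∀ {n} (r : ℕ) (H : Graph n) {F : Subset n} →
                  IsFacet (SigmaC r H) F ⇔ (∃[ W ] ConnectedComplement r H W F)
IsFacet-SigmaC⇔ r H = mk⇔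
  (λ ((W , ∣W∣≡r , conn , F⊆∁W) , maximal) →
     W , ∣W∣≡r , conn , maximal (∁ W) (W , ∣W∣≡r , conn , ⊆-refl) F⊆∁W)
  (λ { (W , ∣W∣≡r , conn , refl) → (W , ∣W∣≡r , conn , ⊆-refl) , ∁-maximal W ∣W∣≡r })
  where
  ∁-maximal : ∀ W → ∣ W ∣ ≡ r → ∀ F′ → SigmaC r H F′ → ∁ W ⊆ F′ → ∁ W ≡ F′
  ∁-maximal W ∣W∣≡r F′ (W′ , ∣W′∣≡r , _ , F′⊆∁W′) ∁W⊆F′ =
    ⊆-antisym ∁W⊆F′ (subst (λ U → F′ ⊆ ∁ U) W′≡W F′⊆∁W′)
    where
    W′≡W : W′ ≡ W
    W′≡W = p⊆q⇒∣p∣≡∣q∣⇒p≡q (∁p⊆∁q⇒p⊇q (λ x∈ → F′⊆∁W′ (∁W⊆F′ x∈)))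
                          (trans ∣W′∣≡r (≡-sym ∣W∣≡r))

IsFacet-Simplex⇔ : ∀ {n} {F : Subset n} → IsFacet (Simplex n) F ⇔ F ≡ ⊤
IsFacet-Simplex⇔ = mk⇔
  (λ (_ , maximal) → maximal ⊤ _ ⊆⊤)
  (λ { refl → _ , λ _ _ ⊤⊆F′ → ⊆-antisym ⊤⊆F′ ⊆⊤ })

walk-source∈ : ∀ {n} {H : Graph n} {U x y} → WalkIn H U x y → x ∈ U
walk-source∈ (here x∈U)     = x∈U
walk-source∈ (step x∈U _ _) = x∈U

module _ {m n} {G : Graph m} {H : Graph n}
         (ι : Fin m → Fin n) (ι-injective : Injective _≡_ _≡_ ι)
         (ι-adj : ∀ {a b} → Adj H (ι a) (ι b) ⇔ Adj G a b)
         {W : Subset m} {U : Subset n}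
         (ι-∈ : ∀ {a} → a ∈ W → ι a ∈ U)
         (∈-image : ∀ {x} → x ∈ U → ∃[ a ] (ι a ≡ x × a ∈ W))
         where

  private
    ι-∈⁻ : ∀ {a} → ι a ∈ U → a ∈ W
    ι-∈⁻ ιa∈U with ∈-image ιa∈U
    ... | _ , ιa′≡ιa , a′∈W with ι-injective ιa′≡ιa
    ...   | refl = a′∈W

    map-walk : ∀ {a b} → WalkIn G W a b → WalkIn H U (ι a) (ι b)
    map-walk (here a∈W)          = here (ι-∈ a∈W)
    map-walk (step a∈W adj walk) = step (ι-∈ a∈W) (from ι-adj adj) (map-walk walk)

    unmap-walk : ∀ {x z a b} → WalkIn H U x z → ι a ≡ x → ι b ≡ z → WalkIn G W a b
    unmap-walk (here ιa∈U) refl ιb≡ιa with ι-injective ιb≡ιa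
    ... | refl = here (ι-∈⁻ ιa∈U)
    unmap-walk (step ιa∈U adj walk) refl refl with ∈-image (walk-source∈ walk)
    ... | _ , refl , _ = step (ι-∈⁻ ιa∈U) (to ι-adj adj) (unmap-walk walk refl refl)

  InducedConnected-image⇔ : InducedConnected H U ⇔ InducedConnected G W
  InducedConnected-image⇔ = mk⇔
    (λ conn a b a∈W b∈W → unmap-walk (conn (ι a) (ι b) (ι-∈ a∈W) (ι-∈ b∈W)) refl refl)
    (λ conn x y x∈U y∈U → image-walk conn (∈-image x∈U) (∈-image y∈U))
    where
    image-walk : ∀ {x y} → InducedConnected G W →
                 ∃[ a ] (ι a ≡ x × a ∈ W) → ∃[ b ] (ι b ≡ y × b ∈ W) → WalkIn H U x y
    image-walk conn (a , refl , a∈W) (b , refl , b∈W) = map-walk (conn a b a∈W b∈W)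

module _ {n₁ n₂ : ℕ} (G₁ : Graph n₁) (G₂ : Graph n₂) where

  private
    J = G₁ *G G₂

  ↑ˡ-adj⇔ : ∀ {a b} → Adj J (a ↑ˡ n₂) (b ↑ˡ n₂) ⇔ Adj G₁ a b
  ↑ˡ-adj⇔ {a} {b} rewrite splitAt-↑ˡ n₁ a n₂ | splitAt-↑ˡ n₁ b n₂ = ⇔.refl

  ↑ʳ-adj⇔ : ∀ {a b} → Adj J (n₁ ↑ʳ a) (n₁ ↑ʳ b) ⇔ Adj G₂ a b
  ↑ʳ-adj⇔ {a} {b} rewrite splitAt-↑ʳ n₁ n₂ a | splitAt-↑ʳ n₁ n₂ b = ⇔.refl

  ↑ˡ-↑ʳ-adj : ∀ {a b} → Adj J (a ↑ˡ n₂) (n₁ ↑ʳ b)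
  ↑ˡ-↑ʳ-adj {a} {b} rewrite splitAt-↑ˡ n₁ a n₂ | splitAt-↑ʳ n₁ n₂ b = _

  ↑ʳ-↑ˡ-adj : ∀ {a b} → Adj J (n₁ ↑ʳ b) (a ↑ˡ n₂)
  ↑ʳ-↑ˡ-adj = sym J ↑ˡ-↑ʳ-adj

  InducedConnected-++⊥⇔ : ∀ {W₁ : Subset n₁} →
                          InducedConnected J (W₁ ++ ⊥) ⇔ InducedConnected G₁ W₁
  InducedConnected-++⊥⇔ {W₁} =
    InducedConnected-image⇔ (_↑ˡ n₂) (↑ˡ-injective n₂ _ _) ↑ˡ-adj⇔ (∈-++⁺ˡ ⊥) (∈-++⊥⁻ W₁)

  InducedConnected-⊥++⇔ : ∀ {W₂ : Subset n₂} →
                          InducedConnected J (⊥ ++ W₂) ⇔ InducedConnected G₂ W₂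
  InducedConnected-⊥++⇔ {W₂} =
    InducedConnected-image⇔ (n₁ ↑ʳ_) (↑ʳ-injective n₁ _ _) ↑ʳ-adj⇔ (∈-++⁺ʳ ⊥) (∈-⊥++⁻ W₂)

  -- Vertices on opposite sides are adjacent, so two vertices of W₁ ++ W₂ are joined directly
  -- or through a vertex on the other side.
  InducedConnected-++ : ∀ {W₁ : Subset n₁} {W₂ : Subset n₂} →
                        Nonempty W₁ → Nonempty W₂ → InducedConnected J (W₁ ++ W₂)
  InducedConnected-++ {W₁} {W₂} (a , a∈W₁) (b , b∈W₂) x y x∈ y∈
    with ∈-++⁻ W₁ x∈ | ∈-++⁻ W₁ y∈
  ... | inj₁ (_ , refl , _) | inj₁ (_ , refl , _) =
    step x∈ ↑ˡ-↑ʳ-adj (step (∈-++⁺ʳ W₁ b∈W₂) ↑ʳ-↑ˡ-adj (here y∈))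
  ... | inj₁ (_ , refl , _) | inj₂ (_ , refl , _) = step x∈ ↑ˡ-↑ʳ-adj (here y∈)
  ... | inj₂ (_ , refl , _) | inj₁ (_ , refl , _) = step x∈ ↑ʳ-↑ˡ-adj (here y∈)
  ... | inj₂ (_ , refl , _) | inj₂ (_ , refl , _) =
    step x∈ ↑ʳ-↑ˡ-adj (step (∈-++⁺ˡ W₂ a∈W₁) ↑ˡ-↑ʳ-adj (here y∈))

  IsJoinFacet-SigmaC-Simplex⇔ : ∀ {r F} → IsJoinFacet (SigmaC r G₁) (Simplex n₂) F ⇔
                                (∃[ W₁ ] ConnectedComplement r J (W₁ ++ ⊥) F)
  IsJoinFacet-SigmaC-Simplex⇔ {r} {F} = mk⇔ join-facet⇒ ⇒join-facet
    where
    join-facet⇒ : IsJoinFacet (SigmaC r G₁) (Simplex n₂) F →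
                  ∃[ W₁ ] ConnectedComplement r J (W₁ ++ ⊥) F
    join-facet⇒ (F₁ , F₂ , F₁-facet , F₂-facet , refl)
      with to (IsFacet-SigmaC⇔ r G₁) F₁-facet | to IsFacet-Simplex⇔ F₂-facet
    ... | W₁ , ∣W₁∣≡r , conn , refl | refl =
      W₁ , trans (∣p++⊥∣≡∣p∣ W₁) ∣W₁∣≡r , from InducedConnected-++⊥⇔ conn ,
      ≡-sym (∁[p++⊥]≡∁p++⊤ W₁)

    ⇒join-facet : ∃[ W₁ ] ConnectedComplement r J (W₁ ++ ⊥) F →
                  IsJoinFacet (SigmaC r G₁) (Simplex n₂) F
    ⇒join-facet (W₁ , ∣W∣≡r , conn , refl) =
      ∁ W₁ , ⊤ ,
      from (IsFacet-SigmaC⇔ r G₁)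
           (W₁ , trans (≡-sym (∣p++⊥∣≡∣p∣ W₁)) ∣W∣≡r , to InducedConnected-++⊥⇔ conn , refl) ,
      from IsFacet-Simplex⇔ refl ,
      ∁[p++⊥]≡∁p++⊤ W₁

  IsJoinFacet-Simplex-SigmaC⇔ : ∀ {r F} → IsJoinFacet (Simplex n₁) (SigmaC r G₂) F ⇔
                                (∃[ W₂ ] ConnectedComplement r J (⊥ ++ W₂) F)
  IsJoinFacet-Simplex-SigmaC⇔ {r} {F} = mk⇔ join-facet⇒ ⇒join-facet
    where
    join-facet⇒ : IsJoinFacet (Simplex n₁) (SigmaC r G₂) F →
                  ∃[ W₂ ] ConnectedComplement r J (⊥ ++ W₂) F
    join-facet⇒ (F₁ , F₂ , F₁-facet , F₂-facet , refl)
      with to IsFacet-Simplex⇔ F₁-facet | to (IsFacet-SigmaC⇔ r G₂) F₂-facet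
    ... | refl | W₂ , ∣W₂∣≡r , conn , refl =
      W₂ , trans (∣⊥++q∣≡∣q∣ {n₁} W₂) ∣W₂∣≡r , from InducedConnected-⊥++⇔ conn ,
      ≡-sym (∁[⊥++q]≡⊤++∁q {n₁} W₂)

    ⇒join-facet : ∃[ W₂ ] ConnectedComplement r J (⊥ ++ W₂) F →
                  IsJoinFacet (Simplex n₁) (SigmaC r G₂) F
    ⇒join-facet (W₂ , ∣W∣≡r , conn , refl) =
      ⊤ , ∁ W₂ ,
      from IsFacet-Simplex⇔ refl ,
      from (IsFacet-SigmaC⇔ r G₂)
           (W₂ , trans (≡-sym (∣⊥++q∣≡∣q∣ {n₁} W₂)) ∣W∣≡r , to InducedConnected-⊥++⇔ conn , refl) ,
      ∁[⊥++q]≡⊤++∁q {n₁} W₂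

lemma3p12 : (n₁ n₂ : ℕ) (G₁ : Graph n₁) (G₂ : Graph n₂) (r : ℕ) → 1 ≤ r →
    (F : Subset (n₁ + n₂)) →
    IsFacet (SigmaC r (G₁ *G G₂)) F ⇔
      (IsJoinFacet (SigmaC r G₁) (Simplex n₂) F
       ⊎ IsJoinFacet (Simplex n₁) (SigmaC r G₂) F
       ⊎ (∃[ E ] (∣ E ∣ ≡ r × Nonempty (E ∩ V₁ n₁ n₂) × Nonempty (E ∩ V₂ n₁ n₂) × F ≡ ∁ E)))
lemma3p12 n₁ n₂ G₁ G₂ r _ F = ⇔.trans (IsFacet-SigmaC⇔ r J) (mk⇔ classify unclassify)
  where
  J : Graph (n₁ + n₂)
  J = G₁ *G G₂

  RHS : Set
  RHS = IsJoinFacet (SigmaC r G₁) (Simplex n₂) F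
      ⊎ IsJoinFacet (Simplex n₁) (SigmaC r G₂) F
      ⊎ (∃[ E ] (∣ E ∣ ≡ r × Nonempty (E ∩ V₁ n₁ n₂) × Nonempty (E ∩ V₂ n₁ n₂) × F ≡ ∁ E))

  classify : ∃[ W ] ConnectedComplement r J W F → RHS
  classify (W , ∣W∣≡r , conn , refl) with Vec.splitAt n₁ W
  ... | W₁ , W₂ , refl with q≡⊥⊎p≡⊥⊎both-nonempty W₁ W₂
  ... | inj₁ refl =
    inj₁ (from (IsJoinFacet-SigmaC-Simplex⇔ G₁ G₂) (W₁ , ∣W∣≡r , conn , refl))
  ... | inj₂ (inj₁ refl) =
    inj₂ (inj₁ (from (IsJoinFacet-Simplex-SigmaC⇔ G₁ G₂) (W₂ , ∣W∣≡r , conn , refl)))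
  ... | inj₂ (inj₂ (W₁-nonempty , W₂-nonempty)) =
    inj₂ (inj₂ (W₁ ++ W₂ , ∣W∣≡r , from (Nonempty-[p++q]∩V₁⇔ W₁ W₂) W₁-nonempty ,
                from (Nonempty-[p++q]∩V₂⇔ W₁ W₂) W₂-nonempty , refl))

  unclassify : RHS → ∃[ W ] ConnectedComplement r J W F
  unclassify (inj₁ join-facet) =
    Product.map (_++ ⊥) id (to (IsJoinFacet-SigmaC-Simplex⇔ G₁ G₂) join-facet)
  unclassify (inj₂ (inj₁ join-facet)) =
    Product.map (⊥ ++_) id (to (IsJoinFacet-Simplex-SigmaC⇔ G₁ G₂) join-facet)
  unclassify (inj₂ (inj₂ (E , ∣E∣≡r , meets-V₁ , meets-V₂ , refl))) with Vec.splitAt n₁ E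
  ... | E₁ , E₂ , refl =
    E₁ ++ E₂ , ∣E∣≡r ,
    InducedConnected-++ G₁ G₂ (to (Nonempty-[p++q]∩V₁⇔ E₁ E₂) meets-V₁)
                              (to (Nonempty-[p++q]∩V₂⇔ E₁ E₂) meets-V₂) ,
    refl
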